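{- Let $R$ be a commutative ring with $1$ and $K=R[x^{\pm1},y^{\pm1}]$. Define $\zeta(x,y):\mathcal{C}\to K$ by $\zeta(x,y)(M)=x^{\operatorname{rk}(M)}y^{|M|-\operatorname{rk}(M)}$, and $\zeta(-x,-y)(M)=(-x)^{\operatorname{rk}(M)}(-y)^{|M|-\operatorname{rk}(M)}$. Then $\zeta(x,y)$ is invertible for the convolution $\circ$ and $\zeta(x,y)^{ -1}=\zeta(-x,-y)$, i.e. $\zeta(x,y)\circ\zeta(-x,-y)=\zeta(-x,-y)\circ\zeta(x,y)=\delta$.
   Context: A ranked set with multiplicities is a triple $(M,\operatorname{rk},m)$ with $M$ a finite set, $\operatorname{rk}:2^M\to\mathbb{Z}$ satisfying $\operatorname{rk}(\emptyset)=0$, and $m:2^M\to R$ arbitrary; $\operatorname{rk}(M)$ is the rank of the whole ground set and $|M|$ its cardinality. $\mathcal{C}$ is the set of isomorphism classes of these (isomorphism = bijection of ground sets preserving rank and multiplicity). Restriction: $M|_A=(A,\operatorname{rk}|_{2^A},m|_{2^A})$. Contraction: $M/A=(M\setminus A,\operatorname{rk}_{M/A},m_{M/A})$ with $\operatorname{rk}_{M/A}(B)=\operatorname{rk}(B\cup A)-\operatorname{rk}(A)$, $m_{M/A}(B)=m(B\cup A)$. For $f,g:\mathcal{C}\to K$, $(f\circ g)(M)=\sum_{A\subseteq M}f(M|_A)g(M/A)$, and $\delta(M)=1$ if $M$ has empty ground set, $0$ otherwise. -}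

module Defs where

open import Level using (Level)
open import Data.Nat as ℕ using (ℕ; zero; suc)
open import Data.Integer as ℤ using (ℤ; +_; -[1+_])
open import Data.Bool using (if_then_else_)
open import Data.Vec using ([]; _∷_)
open import Data.List using (List; []; _∷_; map; _++_; foldr)
open import Data.Fin.Subset using (Subset; inside; outside; ⊥; _∪_; _─_; ∣_∣)
open import Relation.Nullary.Decidable using (⌊_⌋)
open import Relation.Binary.PropositionalEquality using (_≡_)
open import Algebra.Bundles using (CommutativeRing)

-- The ground set M is represented as a subset 'ground' of an ambient Fin N;
-- rk and m are given on all subsets of Fin N, only their values on subsets
-- of 'ground' are meaningful (all operations below only use those values).
record RankedSet {r : Level} (Rc : Set r) : Set r where
  field
    N      : ℕ
    ground : Subset N
    rk     : Subset N → ℤ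
    mult   : Subset N → Rc
    rk-∅   : rk ⊥ ≡ + 0
open RankedSet public

restrict : ∀ {r} {Rc : Set r} (M : RankedSet Rc) → Subset (N M) → RankedSet Rc
restrict M A = record
  { N = N M ; ground = A ; rk = rk M ; mult = mult M ; rk-∅ = rk-∅ M }

contract : ∀ {r} {Rc : Set r} (M : RankedSet Rc) → Subset (N M) → RankedSet Rc
contract M A = record
  { N = N M
  ; ground = ground M ─ A
  ; rk = λ B → rk M (B ∪ A) ℤ.- rk M A
  ; mult = λ B → mult M (B ∪ A)
  ; rk-∅ = lemma
  }
  where
  open import Data.Fin.Subset.Properties using (∪-identityˡ)
  open import Relation.Binary.PropositionalEquality using (cong; trans)
  open import Data.Integer.Properties using (+-inverseʳ)
  lemma : rk M (⊥ ∪ A) ℤ.- rk M A ≡ + 0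
  lemma = trans (cong (λ S → rk M S ℤ.- rk M A) (∪-identityˡ A)) (+-inverseʳ (rk M A))

subsetsOf : ∀ {n} → Subset n → List (Subset n)
subsetsOf [] = [] ∷ []
subsetsOf (inside ∷ g)  = map (inside ∷_) (subsetsOf g) ++ map (outside ∷_) (subsetsOf g)
subsetsOf (outside ∷ g) = map (outside ∷_) (subsetsOf g)

rank : ∀ {r} {Rc : Set r} → RankedSet Rc → ℤ
rank M = rk M (ground M)

card : ∀ {r} {Rc : Set r} → RankedSet Rc → ℕ
card M = ∣ ground M ∣

module _ {c ℓ : Level} (K : CommutativeRing c ℓ) where
  open CommutativeRing K

  npow : Carrier → ℕ → Carrier
  npow a zero    = 1#
  npow a (suc n) = a * npow a n

  -- integer power of a unit a with given inverse ainv
  zpow : Carrier → Carrier → ℤ → Carrier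
  zpow a ainv (+ n)      = npow a n
  zpow a ainv -[1+ n ]   = npow ainv (suc n)

  module _ {r : Level} (Rc : Set r) where
    conv : (RankedSet Rc → Carrier) → (RankedSet Rc → Carrier) → RankedSet Rc → Carrier
    conv f g M = foldr (λ A s → f (restrict M A) * g (contract M A) + s) 0#
                       (subsetsOf (ground M))

    δ : RankedSet Rc → Carrier
    δ M = if ⌊ card M ℕ.≟ 0 ⌋ then 1# else 0#

    ζ : Carrier → Carrier → Carrier → Carrier → RankedSet Rc → Carrier
    ζ a ainv b binv M =
      zpow a ainv (rank M) * zpow b binv ((+ card M) ℤ.- rank M)

-- Write X = x^(·), Y = y^(·) (integer powers of units) and, for an integer
-- r and a natural n, monomial r n = x^r y^(n-r), so that ζ(x,y)(M) =
-- monomial (rk M) |M|.  Integer powers are exponential in the exponent,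
-- hence monomial r a · monomial (g - r) b = monomial g (a + b), and flipping
-- the signs of x and y multiplies monomial r n by (-1)^n.  For A ⊆ G = M the
-- contraction M/A has rank rk G - rk A and size |G ∖ A|, so every term of
--   (ζ(x,y) ∘ ζ(-x,-y))(M)   resp.   (ζ(-x,-y) ∘ ζ(x,y))(M)
-- equals (-1)^|G∖A| · ζ(x,y)(M)   resp.   (-1)^|A| · ζ(x,y)(M).
-- Both alternating sums Σ_{A ⊆ G} (-1)^|G∖A| and Σ_{A ⊆ G} (-1)^|A| equal
-- [G = ∅], and ζ(x,y)(M) = 1 when G = ∅; this is δ(M).
module Submission where

open import Defs
open import Level using (Level)
open import Data.Product using (_×_; _,_)
open import Algebra.Bundles using (CommutativeRing)
open import Data.Nat as ℕ using (ℕ; zero; suc)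
import Data.Nat.Properties as ℕP
open import Data.Integer as ℤ using (ℤ; +_; -[1+_]; _⊖_)
import Data.Integer.Properties as ℤP
open import Data.Integer.Tactic.RingSolver using (solve-∀)
open import Data.Bool using (if_then_else_)
open import Data.Vec using ([]; _∷_)
open import Data.List using (List; []; _∷_; map; _++_; foldr)
open import Data.List.Relation.Unary.All as All using (All; []; _∷_)
open import Data.List.Relation.Unary.All.Properties using (map⁺; ++⁺)
open import Data.Fin.Subset using (Subset; inside; outside; ⊥; _∪_; _─_; ∣_∣)
open import Relation.Nullary.Decidable using (⌊_⌋)
open import Relation.Binary.PropositionalEquality as P using (_≡_)

⊖-+-⊖ : ∀ a b c d → (a ⊖ b) ℤ.+ (c ⊖ d) ≡ (a ℕ.+ c) ⊖ (b ℕ.+ d)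
⊖-+-⊖ a b c d = begin
    (a ⊖ b) ℤ.+ (c ⊖ d)
  ≡⟨ P.cong₂ ℤ._+_ (P.sym (ℤP.m-n≡m⊖n a b)) (P.sym (ℤP.m-n≡m⊖n c d)) ⟩
    (+ a ℤ.- + b) ℤ.+ (+ c ℤ.- + d)
  ≡⟨ regroup (+ a) (+ b) (+ c) (+ d) ⟩
    (+ a ℤ.+ + c) ℤ.- (+ b ℤ.+ + d)
  ≡⟨ P.cong₂ ℤ._-_ (P.sym (ℤP.pos-+ a c)) (P.sym (ℤP.pos-+ b d)) ⟩
    + (a ℕ.+ c) ℤ.- + (b ℕ.+ d)
  ≡⟨ ℤP.m-n≡m⊖n (a ℕ.+ c) (b ℕ.+ d) ⟩
    (a ℕ.+ c) ⊖ (b ℕ.+ d) ∎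
  where
  open P.≡-Reasoning
  regroup : ∀ (a b c d : ℤ) → (a ℤ.- b) ℤ.+ (c ℤ.- d) ≡ (a ℤ.+ c) ℤ.- (b ℤ.+ d)
  regroup = solve-∀

pos neg : ℤ → ℕ
pos (+ n)    = n
pos -[1+ n ] = 0
neg (+ n)    = 0
neg -[1+ n ] = suc n

pos⊖neg : ∀ i → i ≡ pos i ⊖ neg i
pos⊖neg (+ n)    = P.refl
pos⊖neg -[1+ n ] = P.refl

-- A splits G: the complement G ∖ A together with A recovers G, and the
-- sizes add up.  This is what turns a contraction term into a ζ of M.
Splits : ∀ {n} → Subset n → Subset n → Set
Splits G A = ((G ─ A) ∪ A ≡ G) × (∣ G ∣ ≡ ∣ A ∣ ℕ.+ ∣ G ─ A ∣)

subsetsOf-split : ∀ {n} (G : Subset n) → All (Splits G) (subsetsOf G)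
subsetsOf-split []            = (P.refl , P.refl) ∷ []
subsetsOf-split (inside ∷ G)  =
  ++⁺ (map⁺ (All.map keep (subsetsOf-split G))) (map⁺ (All.map drop (subsetsOf-split G)))
  where
  keep : ∀ {A} → Splits G A → Splits (inside ∷ G) (inside ∷ A)
  keep (e , c) = P.cong (inside ∷_) e , P.cong suc c
  drop : ∀ {A} → Splits G A → Splits (inside ∷ G) (outside ∷ A)
  drop {A} (e , c) = P.cong (inside ∷_) e , P.trans (P.cong suc c) (P.sym (ℕP.+-suc ∣ A ∣ _))
subsetsOf-split (outside ∷ G) =
  map⁺ (All.map (λ { (e , c) → P.cong (outside ∷_) e , c }) (subsetsOf-split G))

∣p∣≡0⇒p≡⊥ : ∀ {n} (p : Subset n) → ∣ p ∣ ≡ 0 → p ≡ ⊥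
∣p∣≡0⇒p≡⊥ []            _ = P.refl
∣p∣≡0⇒p≡⊥ (inside ∷ p)  ()
∣p∣≡0⇒p≡⊥ (outside ∷ p) e = P.cong (outside ∷_) (∣p∣≡0⇒p≡⊥ p e)

module _ {c ℓ : Level} (K : CommutativeRing c ℓ) where
  open CommutativeRing K
  open import Relation.Binary.Reasoning.Setoid setoid
  open import Algebra.Properties.Ring ring using (-1*x≈-x; -‿involutive)
  open import Algebra.Properties.CommutativeSemigroup *-commutativeSemigroup
    using (interchange; x∙yz≈y∙xz)
  open import Algebra.Properties.CommutativeSemiring.Exp commutativeSemiring
    using (_^_; ^-homo-*; ^-distrib-*; ^-congˡ)

  ≡⇒≈ : ∀ {a b} → a ≡ b → a ≈ b
  ≡⇒≈ P.refl = refl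

  npow≡^ : ∀ a n → npow K a n ≡ a ^ n
  npow≡^ a zero    = P.refl
  npow≡^ a (suc n) = P.cong (a *_) (npow≡^ a n)

  npow-+ : ∀ a m n → npow K a (m ℕ.+ n) ≈ npow K a m * npow K a n
  npow-+ a m n rewrite npow≡^ a (m ℕ.+ n) | npow≡^ a m | npow≡^ a n = ^-homo-* a m n

  npow-distrib-* : ∀ a b n → npow K (a * b) n ≈ npow K a n * npow K b n
  npow-distrib-* a b n rewrite npow≡^ (a * b) n | npow≡^ a n | npow≡^ b n = ^-distrib-* a b n

  npow-cong : ∀ {a b} n → a ≈ b → npow K a n ≈ npow K b n
  npow-cong {a} {b} n e rewrite npow≡^ a n | npow≡^ b n = ^-congˡ n e

  -- u^(m ⊖ n) = u^m v^n, by cancelling u v = 1 once per common step.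
  zpow-⊖ : ∀ u v → u * v ≈ 1# → ∀ m n → zpow K u v (m ⊖ n) ≈ npow K u m * npow K v n
  zpow-⊖ u v uv≈1 zero    zero    = sym (*-identityˡ 1#)
  zpow-⊖ u v uv≈1 (suc m) zero    = sym (*-identityʳ _)
  zpow-⊖ u v uv≈1 zero    (suc n) = sym (*-identityˡ _)
  zpow-⊖ u v uv≈1 (suc m) (suc n) = begin
      zpow K u v (suc m ⊖ suc n)
    ≡⟨ P.cong (zpow K u v) (ℤP.[1+m]⊖[1+n]≡m⊖n m n) ⟩
      zpow K u v (m ⊖ n)
    ≈⟨ zpow-⊖ u v uv≈1 m n ⟩
      npow K u m * npow K v n
    ≈⟨ sym (*-identityˡ _) ⟩
      1# * (npow K u m * npow K v n)
    ≈⟨ *-congʳ (sym uv≈1) ⟩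
      (u * v) * (npow K u m * npow K v n)
    ≈⟨ interchange u v _ _ ⟩
      (u * npow K u m) * (v * npow K v n) ∎

  zpow-+ : ∀ u v → u * v ≈ 1# → ∀ i j → zpow K u v (i ℤ.+ j) ≈ zpow K u v i * zpow K u v j
  zpow-+ u v uv≈1 i j = begin
      zpow K u v (i ℤ.+ j)
    ≡⟨ P.cong (zpow K u v) (P.cong₂ ℤ._+_ (pos⊖neg i) (pos⊖neg j)) ⟩
      zpow K u v ((pos i ⊖ neg i) ℤ.+ (pos j ⊖ neg j))
    ≡⟨ P.cong (zpow K u v) (⊖-+-⊖ (pos i) (neg i) (pos j) (neg j)) ⟩
      zpow K u v ((pos i ℕ.+ pos j) ⊖ (neg i ℕ.+ neg j))
    ≈⟨ zpow-⊖ u v uv≈1 (pos i ℕ.+ pos j) (neg i ℕ.+ neg j) ⟩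
      npow K u (pos i ℕ.+ pos j) * npow K v (neg i ℕ.+ neg j)
    ≈⟨ *-cong (npow-+ u (pos i) (pos j)) (npow-+ v (neg i) (neg j)) ⟩
      (npow K u (pos i) * npow K u (pos j)) * (npow K v (neg i) * npow K v (neg j))
    ≈⟨ interchange _ _ _ _ ⟩
      (npow K u (pos i) * npow K v (neg i)) * (npow K u (pos j) * npow K v (neg j))
    ≈⟨ sym (*-cong (split i) (split j)) ⟩
      zpow K u v i * zpow K u v j ∎
    where
    split : ∀ i → zpow K u v i ≈ npow K u (pos i) * npow K v (neg i)
    split i = trans (≡⇒≈ (P.cong (zpow K u v) (pos⊖neg i))) (zpow-⊖ u v uv≈1 (pos i) (neg i))

  zpow-distrib-* : ∀ a b u v i → zpow K (a * u) (b * v) i ≈ zpow K a b i * zpow K u v i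
  zpow-distrib-* a b u v (+ n)    = npow-distrib-* a u n
  zpow-distrib-* a b u v -[1+ n ] = npow-distrib-* b v (suc n)

  zpow-cong : ∀ {u u' v v'} i → u ≈ u' → v ≈ v' → zpow K u v i ≈ zpow K u' v' i
  zpow-cong (+ n)    eu ev = npow-cong n eu
  zpow-cong -[1+ n ] eu ev = npow-cong (suc n) ev

  sign : ℤ → Carrier
  sign = zpow K (- 1#) (- 1#)

  -- -1 is its own inverse, so sign is an integer power of a unit.
  -1*-1≈1 : - 1# * - 1# ≈ 1#
  -1*-1≈1 = trans (-1*x≈-x (- 1#)) (-‿involutive 1#)

  zpow-neg : ∀ u v i → zpow K (- u) (- v) i ≈ sign i * zpow K u v i
  zpow-neg u v i = trans (zpow-cong i (sym (-1*x≈-x u)) (sym (-1*x≈-x v)))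
                         (zpow-distrib-* (- 1#) (- 1#) u v i)

  monomial : (a ainv b binv : Carrier) → ℤ → ℕ → Carrier
  monomial a ainv b binv r n = zpow K a ainv r * zpow K b binv (+ n ℤ.- r)

  monomial-neg : ∀ a ainv b binv r n →
    monomial (- a) (- ainv) (- b) (- binv) r n ≈ npow K (- 1#) n * monomial a ainv b binv r n
  monomial-neg a ainv b binv r n = begin
      zpow K (- a) (- ainv) r * zpow K (- b) (- binv) (+ n ℤ.- r)
    ≈⟨ *-cong (zpow-neg a ainv r) (zpow-neg b binv (+ n ℤ.- r)) ⟩
      (sign r * zpow K a ainv r) * (sign (+ n ℤ.- r) * zpow K b binv (+ n ℤ.- r))
    ≈⟨ interchange _ _ _ _ ⟩
      (sign r * sign (+ n ℤ.- r)) * monomial a ainv b binv r n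
    ≈⟨ *-congʳ (sym (zpow-+ (- 1#) (- 1#) -1*-1≈1 r (+ n ℤ.- r))) ⟩
      sign (r ℤ.+ (+ n ℤ.- r)) * monomial a ainv b binv r n
    ≡⟨ P.cong (λ i → sign i * monomial a ainv b binv r n) (r+[g-r]≡g r (+ n)) ⟩
      npow K (- 1#) n * monomial a ainv b binv r n ∎
    where
    r+[g-r]≡g : ∀ (r g : ℤ) → r ℤ.+ (g ℤ.- r) ≡ g
    r+[g-r]≡g = solve-∀

  monomial-split : ∀ a ainv b binv → a * ainv ≈ 1# → b * binv ≈ 1# → ∀ r g k l →
    monomial a ainv b binv r k * monomial a ainv b binv (g ℤ.- r) l
      ≈ monomial a ainv b binv g (k ℕ.+ l)
  monomial-split a ainv b binv a-unit b-unit r g k l = begin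
      (zpow K a ainv r * zpow K b binv (+ k ℤ.- r))
        * (zpow K a ainv (g ℤ.- r) * zpow K b binv (+ l ℤ.- (g ℤ.- r)))
    ≈⟨ interchange _ _ _ _ ⟩
      (zpow K a ainv r * zpow K a ainv (g ℤ.- r))
        * (zpow K b binv (+ k ℤ.- r) * zpow K b binv (+ l ℤ.- (g ℤ.- r)))
    ≈⟨ sym (*-cong (zpow-+ a ainv a-unit r (g ℤ.- r))
                   (zpow-+ b binv b-unit (+ k ℤ.- r) (+ l ℤ.- (g ℤ.- r)))) ⟩
      zpow K a ainv (r ℤ.+ (g ℤ.- r)) * zpow K b binv ((+ k ℤ.- r) ℤ.+ (+ l ℤ.- (g ℤ.- r)))
    ≡⟨ P.cong₂ (λ i j → zpow K a ainv i * zpow K b binv j) (rank-sum r g)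
         (P.trans (size-sum r g (+ k) (+ l)) (P.cong (ℤ._- g) (P.sym (ℤP.pos-+ k l)))) ⟩
      zpow K a ainv g * zpow K b binv (+ (k ℕ.+ l) ℤ.- g) ∎
    where
    rank-sum : ∀ (r g : ℤ) → r ℤ.+ (g ℤ.- r) ≡ g
    rank-sum = solve-∀
    size-sum : ∀ (r g k l : ℤ) → (k ℤ.- r) ℤ.+ (l ℤ.- (g ℤ.- r)) ≡ (k ℤ.+ l) ℤ.- g
    size-sum = solve-∀

  -- On a ranked set with empty ground set every ζ equals 1, since rk ∅ = 0.
  ζ-empty : ∀ {r} {Rc : Set r} a ainv b binv (M : RankedSet Rc) →
    card M ≡ 0 → ζ K Rc a ainv b binv M ≈ 1#
  ζ-empty a ainv b binv M e =
    trans (≡⇒≈ (P.cong₂ (λ i k → zpow K a ainv i * zpow K b binv (+ k ℤ.- i)) rank≡0 e))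
          (*-identityˡ 1#)
    where
    rank≡0 : rank M ≡ + 0
    rank≡0 = P.trans (P.cong (rk M) (∣p∣≡0⇒p≡⊥ (ground M) e)) (rk-∅ M)

  sumOver : ∀ {n} → (Subset n → Carrier) → List (Subset n) → Carrier
  sumOver f L = foldr (λ A s → f A + s) 0# L

  sum-cong : ∀ {n} {Q : Subset n → Set} (f g : Subset n → Carrier) →
    (∀ {A} → Q A → f A ≈ g A) → ∀ {L} → All Q L → sumOver f L ≈ sumOver g L
  sum-cong f g f≈g []       = refl
  sum-cong f g f≈g (q ∷ qs) = +-cong (f≈g q) (sum-cong f g f≈g qs)

  sum-*ˡ : ∀ {n} (f : Subset n → Carrier) C L → sumOver (λ A → C * f A) L ≈ C * sumOver f L
  sum-*ˡ f C []      = sym (zeroʳ C)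
  sum-*ˡ f C (A ∷ L) = trans (+-congˡ (sum-*ˡ f C L)) (sym (distribˡ C _ _))

  sum-*ʳ : ∀ {n} (f : Subset n → Carrier) C L → sumOver (λ A → f A * C) L ≈ sumOver f L * C
  sum-*ʳ f C []      = sym (zeroˡ C)
  sum-*ʳ f C (A ∷ L) = trans (+-congˡ (sum-*ʳ f C L)) (sym (distribʳ C _ _))

  sum-map : ∀ {n k} (f : Subset n → Carrier) (h : Subset k → Subset n) L →
    sumOver f (map h L) ≈ sumOver (λ A → f (h A)) L
  sum-map f h []      = refl
  sum-map f h (A ∷ L) = +-congˡ (sum-map f h L)

  sum-++ : ∀ {n} (f : Subset n → Carrier) L L' → sumOver f (L ++ L') ≈ sumOver f L + sumOver f L'
  sum-++ f []      L' = sym (+-identityˡ _)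
  sum-++ f (A ∷ L) L' = trans (+-congˡ (sum-++ f L L')) (sym (+-assoc _ _ _))

  sum-subsets-inside : ∀ {n} (f : Subset (suc n) → Carrier) (G : Subset n) →
    sumOver f (subsetsOf (inside ∷ G))
      ≈ sumOver (λ A → f (inside ∷ A)) (subsetsOf G) + sumOver (λ A → f (outside ∷ A)) (subsetsOf G)
  sum-subsets-inside f G = trans (sum-++ f (map (inside ∷_) L) (map (outside ∷_) L))
                                 (+-cong (sum-map f _ L) (sum-map f _ L))
    where L = subsetsOf G

  -- The indicator [k = 0], in the form in which δ is defined.
  isZero : ℕ → Carrier
  isZero k = if ⌊ k ℕ.≟ 0 ⌋ then 1# else 0#

  alternating-complement : ∀ {n} (G : Subset n) →
    sumOver (λ A → npow K (- 1#) ∣ G ─ A ∣) (subsetsOf G) ≈ isZero ∣ G ∣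
  alternating-complement []            = +-identityʳ 1#
  alternating-complement (inside ∷ G)  = begin
      sumOver (λ A → npow K (- 1#) ∣ (inside ∷ G) ─ A ∣) (subsetsOf (inside ∷ G))
    ≈⟨ sum-subsets-inside _ G ⟩
      sumOver s (subsetsOf G) + sumOver (λ A → - 1# * s A) (subsetsOf G)
    ≈⟨ +-congˡ (trans (sum-*ˡ s (- 1#) (subsetsOf G)) (-1*x≈-x _)) ⟩
      sumOver s (subsetsOf G) - sumOver s (subsetsOf G)
    ≈⟨ -‿inverseʳ _ ⟩
      0# ∎
    where
    s : Subset _ → Carrier
    s A = npow K (- 1#) ∣ G ─ A ∣
  alternating-complement (outside ∷ G) =
    trans (sum-map _ _ (subsetsOf G)) (alternating-complement G)

  alternating : ∀ {n} (G : Subset n) →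
    sumOver (λ A → npow K (- 1#) ∣ A ∣) (subsetsOf G) ≈ isZero ∣ G ∣
  alternating []            = +-identityʳ 1#
  alternating (inside ∷ G)  = begin
      sumOver (λ A → npow K (- 1#) ∣ A ∣) (subsetsOf (inside ∷ G))
    ≈⟨ sum-subsets-inside _ G ⟩
      sumOver (λ A → - 1# * s A) (subsetsOf G) + sumOver s (subsetsOf G)
    ≈⟨ +-congʳ (trans (sum-*ˡ s (- 1#) (subsetsOf G)) (-1*x≈-x _)) ⟩
      - sumOver s (subsetsOf G) + sumOver s (subsetsOf G)
    ≈⟨ -‿inverseˡ _ ⟩
      0# ∎
    where
    s : Subset _ → Carrier
    s A = npow K (- 1#) ∣ A ∣
  alternating (outside ∷ G) = trans (sum-map _ _ (subsetsOf G)) (alternating G)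

  module _ {r : Level} {Rc : Set r} where

    conv-δ : ∀ (f g : RankedSet Rc → Carrier) (M : RankedSet Rc) (s : Subset (N M) → Carrier) c →
      (∀ {A} → Splits (ground M) A → f (restrict M A) * g (contract M A) ≈ s A * c) →
      sumOver s (subsetsOf (ground M)) ≈ isZero (card M) →
      (card M ≡ 0 → c ≈ 1#) →
      conv K Rc f g M ≈ δ K Rc M
    conv-δ f g M s c term Σs c≈1 = begin
        sumOver (λ A → f (restrict M A) * g (contract M A)) (subsetsOf G)
      ≈⟨ sum-cong _ _ term (subsetsOf-split G) ⟩
        sumOver (λ A → s A * c) (subsetsOf G)
      ≈⟨ sum-*ʳ s c (subsetsOf G) ⟩
        sumOver s (subsetsOf G) * c
      ≈⟨ *-congʳ Σs ⟩
        isZero ∣ G ∣ * c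
      ≈⟨ indicator-absorbs ∣ G ∣ c≈1 ⟩
        isZero ∣ G ∣ ∎
      where
      G = ground M
      indicator-absorbs : ∀ k → (k ≡ 0 → c ≈ 1#) → isZero k * c ≈ isZero k
      indicator-absorbs zero    c≈1 = trans (*-identityˡ c) (c≈1 P.refl)
      indicator-absorbs (suc k) _   = zeroˡ c

    module _ (x xinv y yinv : Carrier) (x-unit : x * xinv ≈ 1#) (y-unit : y * yinv ≈ 1#) where

      ζ⁺ ζ⁻ : RankedSet Rc → Carrier
      ζ⁺ = ζ K Rc x xinv y yinv
      ζ⁻ = ζ K Rc (- x) (- xinv) (- y) (- yinv)

      mono : ℤ → ℕ → Carrier
      mono = monomial x xinv y yinv

      mono-split : ∀ (M : RankedSet Rc) {A} → Splits (ground M) A →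
        mono (rk M A) ∣ A ∣ * mono (rk M ((ground M ─ A) ∪ A) ℤ.- rk M A) ∣ ground M ─ A ∣ ≈ ζ⁺ M
      mono-split M {A} (complement∪A≡G , size) = begin
          mono (rk M A) ∣ A ∣ * mono (rk M ((G ─ A) ∪ A) ℤ.- rk M A) ∣ G ─ A ∣
        ≡⟨ P.cong (λ S → mono (rk M A) ∣ A ∣ * mono (rk M S ℤ.- rk M A) ∣ G ─ A ∣) complement∪A≡G ⟩
          mono (rk M A) ∣ A ∣ * mono (rk M G ℤ.- rk M A) ∣ G ─ A ∣
        ≈⟨ monomial-split x xinv y yinv x-unit y-unit (rk M A) (rk M G) ∣ A ∣ ∣ G ─ A ∣ ⟩
          mono (rk M G) (∣ A ∣ ℕ.+ ∣ G ─ A ∣)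
        ≡⟨ P.cong (mono (rk M G)) (P.sym size) ⟩
          mono (rk M G) ∣ G ∣ ∎
        where G = ground M

      -- (ζ(x,y) ∘ ζ(-x,-y))(M) = δ(M): the term at A is (-1)^|G∖A| ζ(x,y)(M).
      ζ⁺∘ζ⁻ : ∀ M → conv K Rc ζ⁺ ζ⁻ M ≈ δ K Rc M
      ζ⁺∘ζ⁻ M = conv-δ ζ⁺ ζ⁻ M (λ A → npow K (- 1#) ∣ ground M ─ A ∣) (ζ⁺ M)
        (λ {A} splits → trans (*-congˡ (monomial-neg x xinv y yinv
                          (rk M ((ground M ─ A) ∪ A) ℤ.- rk M A) ∣ ground M ─ A ∣))
                        (trans (x∙yz≈y∙xz _ _ _) (*-congˡ (mono-split M splits))))
        (alternating-complement (ground M))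
        (ζ-empty x xinv y yinv M)

      -- (ζ(-x,-y) ∘ ζ(x,y))(M) = δ(M): the term at A is (-1)^|A| ζ(x,y)(M).
      ζ⁻∘ζ⁺ : ∀ M → conv K Rc ζ⁻ ζ⁺ M ≈ δ K Rc M
      ζ⁻∘ζ⁺ M = conv-δ ζ⁻ ζ⁺ M (λ A → npow K (- 1#) ∣ A ∣) (ζ⁺ M)
        (λ {A} splits → trans (*-congʳ (monomial-neg x xinv y yinv (rk M A) ∣ A ∣))
                        (trans (*-assoc _ _ _) (*-congˡ (mono-split M splits))))
        (alternating (ground M))
        (ζ-empty x xinv y yinv M)

lemma3p2 : ∀ {c ℓ r ℓr : Level} (R : CommutativeRing r ℓr) (K : CommutativeRing c ℓ)
           → let open CommutativeRing K in
           (x xinv y yinv : Carrier) → x * xinv ≈ 1# → y * yinv ≈ 1#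
           → (M : RankedSet (CommutativeRing.Carrier R))
           → conv K (CommutativeRing.Carrier R)
               (ζ K (CommutativeRing.Carrier R) x xinv y yinv)
               (ζ K (CommutativeRing.Carrier R) (- x) (- xinv) (- y) (- yinv)) M
             ≈ δ K (CommutativeRing.Carrier R) M
           × conv K (CommutativeRing.Carrier R)
               (ζ K (CommutativeRing.Carrier R) (- x) (- xinv) (- y) (- yinv))
               (ζ K (CommutativeRing.Carrier R) x xinv y yinv) M
             ≈ δ K (CommutativeRing.Carrier R) M
lemma3p2 R K x xinv y yinv x-unit y-unit M =
  ζ⁺∘ζ⁻ K x xinv y yinv x-unit y-unit M , ζ⁻∘ζ⁺ K x xinv y yinv x-unit y-unit M
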